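{- Let $p$ be prime, $m\ge1$, $n=2m+1$, and $G=\mathbb U_{m+1}(\mathbb F_p)\times\mathbb U_{m+1}(\mathbb F_p)$. The cohomology class in $H^2(G,S_n)$ of the extension $0\to S_n\to\mathbb U_n(\mathbb F_p)\to G\to1$ equals the cup product $\phi_1\smile\phi_2$, computed with respect to the $G$-equivariant pairing $V_m\otimes V_m^*\to S_n$, $v\otimes r\mapsto vr$.
   Context: $\mathbb U_k(\mathbb F_p)$: upper unitriangular $k\times k$ matrices over $\mathbb F_p$. $S_n\subset\mathbb U_n$ is the abelian normal subgroup of matrices $I+h$ with $h$ supported in rows $1,\dots,m$, columns $m+2,\dots,2m+1$; it is identified with the additive group of $m\times m$ matrices $X$ (that block). The map $\mathbb U_n\to G$ sends $g$ to (its top-left $(m+1)\times(m+1)$ block, its bottom-right $(m+1)\times(m+1)$ block); its kernel is $S_n$, and $G$ acts on $S_n$ by conjugation, namely $(g_1,g_2)\cdot X=\pi(g_1)X\pi'(g_2)^{ -1}$, where $\pi,\pi'\colon\mathbb U_{m+1}\to\mathbb U_m$ delete respectively the last row and column, and the first row and column. $V_m$ = column vectors in $\mathbb F_p^m$ with $(g_1,g_2)\cdot v=\pi(g_1)v$; $V_m^*$ = row vectors with $(g_1,g_2)\cdot r=r\,\pi'(g_2)^{ -1}$. For $g\in\mathbb U_{m+1}$ let $\phi(g)\in V_m$ be the last column of $g$ with its last entry deleted, and $\psi(g)\in V_m^*$ the first row of $g$ with its first entry deleted. The 1-cocycles are $\phi_1(g_1,g_2)=\phi(g_1)\in V_m$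 and $\phi_2(g_1,g_2)=\psi(g_2)\pi'(g_2)^{ -1}\in V_m^*$. The cup product is represented by the 2-cocycle $(g,g')\mapsto\phi_1(g)\,(g\cdot\phi_2(g'))$; the class of an extension is that of the 2-cocycle arising from a set-theoretic section. -}

module Defs where

open import Data.Nat using (ℕ; zero; suc; _+_; _*_; _∸_; NonZero)
open import Data.Nat.Properties using (+-suc)
open import Data.Nat.DivMod using (_mod_)
open import Data.Fin using (Fin; zero; suc; toℕ; inject₁; _↑ˡ_; _↑ʳ_; fromℕ; cast; splitAt; _≟_)
open import Data.Sum using (inj₁; inj₂)
open import Data.Product using (Σ; _×_; _,_; proj₁; proj₂)
open import Relation.Nullary using (yes; no)
open import Relation.Binary.PropositionalEquality using (_≡_; sym)
open import Data.Nat using (_<_)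

module _ (p : ℕ) .{{_ : NonZero p}} where

  F : Set
  F = Fin p

  0F 1F : F
  0F = 0 mod p
  1F = 1 mod p

  _+F_ _*F_ : F → F → F
  a +F b = (toℕ a + toℕ b) mod p
  a *F b = (toℕ a * toℕ b) mod p

  -F_ : F → F
  -F a = (p ∸ toℕ a) mod p

  ΣF : ∀ {k} → (Fin k → F) → F
  ΣF {zero}  f = 0F
  ΣF {suc k} f = f zero +F ΣF (λ i → f (suc i))

  Mat : ℕ → ℕ → Set
  Mat r c = Fin r → Fin c → F

  _≈M_ : ∀ {r c} → Mat r c → Mat r c → Set
  A ≈M B = ∀ i j → A i j ≡ B i j

  idM : ∀ {k} → Mat k k
  idM i j with i ≟ j
  ... | yes _ = 1F
  ... | no  _ = 0F

  zeroM : ∀ {r c} → Mat r c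
  zeroM i j = 0F

  _+M_ : ∀ {r c} → Mat r c → Mat r c → Mat r c
  (A +M B) i j = A i j +F B i j

  -M_ : ∀ {r c} → Mat r c → Mat r c
  (-M A) i j = -F (A i j)

  _·M_ : ∀ {r k c} → Mat r k → Mat k c → Mat r c
  (A ·M B) i j = ΣF (λ l → A i l *F B l j)

  powM : ∀ {k} → Mat k k → ℕ → Mat k k
  powM A zero    = idM
  powM A (suc e) = A ·M powM A e

  geomM : ∀ {k} → Mat k k → ℕ → Mat k k
  geomM N zero    = zeroM
  geomM N (suc t) = geomM N t +M powM N t

  -- Inverse of a unitriangular k×k matrix A:  A⁻¹ = Σ_{e<k} (I - A)^e
  -- (valid since I - A is strictly upper triangular, hence (I-A)^k = 0).
  uinv : ∀ {k} → Mat k k → Mat k k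
  uinv {k} A = geomM (idM +M (-M A)) k

  IsUnitri : ∀ {k} → Mat k k → Set
  IsUnitri A = ∀ i j → (toℕ j < toℕ i → A i j ≡ 0F) × (i ≡ j → A i j ≡ 1F)

  U : ℕ → Set
  U k = Σ (Mat k k) IsUnitri

  module Setting (m : ℕ) where

    n : ℕ
    n = suc (m + m)

    M₁ : Set
    M₁ = Mat (suc m) (suc m)

    Gm : Set
    Gm = M₁ × M₁

    InG : Gm → Set
    InG (g₁ , g₂) = IsUnitri g₁ × IsUnitri g₂

    _∙G_ : Gm → Gm → Gm
    (a₁ , a₂) ∙G (b₁ , b₂) = (a₁ ·M b₁) , (a₂ ·M b₂)

    π π' : M₁ → Mat m m
    π  g i j = g (inject₁ i) (inject₁ j)
    π' g i j = g (suc i) (suc j)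

    -- V_m = column vectors, V_m^* = row vectors, both as Fin m → F.
    Vec' : Set
    Vec' = Fin m → F

    _ᵣ·_ : Vec' → Mat m m → Vec'
    (r ᵣ· A) j = ΣF (λ l → r l *F A l j)

    φ : M₁ → Vec'
    φ g i = g (inject₁ i) (fromℕ m)

    ψ : M₁ → Vec'
    ψ g j = g zero (suc j)

    φ₁ : Gm → Vec'
    φ₁ (g₁ , g₂) = φ g₁

    φ₂ : Gm → Vec'
    φ₂ (g₁ , g₂) = ψ g₂ ᵣ· uinv (π' g₂)

    actV* : Gm → Vec' → Vec'
    actV* (g₁ , g₂) r = r ᵣ· uinv (π' g₂)

    -- action of G on S_n ≅ m×m matrices
    actS : Gm → Mat m m → Mat m m
    actS (g₁ , g₂) X = (π g₁ ·M X) ·M uinv (π' g₂)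

    pair : Vec' → Vec' → Mat m m
    pair v r i j = v i *F r j

    cup : Gm → Gm → Mat m m
    cup g g' = pair (φ₁ g) (actV* g (φ₂ g'))

    δ : (Gm → Mat m m) → Gm → Gm → Mat m m
    δ f g g' = (actS g (f g') +M (-M f (g ∙G g'))) +M f g

    shiftR : Fin (suc m) → Fin n
    shiftR i = cast (+-suc m m) (m ↑ʳ i)

    topLeft bottomRight : Mat n n → M₁
    topLeft     A i j = A (i ↑ˡ m) (j ↑ˡ m)
    bottomRight A i j = A (shiftR i) (shiftR j)

    q : Mat n n → Gm
    q A = topLeft A , bottomRight A

    -- embedding of S_n: X placed in rows 1..m, columns m+2..2m+1
    embedS : Mat m m → Mat n n
    embedS X i j with splitAt m (cast (sym (+-suc m m)) i) | splitAt (suc m) j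
    ... | inj₁ r | inj₂ c = X r c
    ... | _      | _      = 0F

    IsSection : (Gm → Mat n n) → Set
    IsSection s = ∀ g → InG g →
      IsUnitri (s g) × (topLeft (s g) ≈M proj₁ g) × (bottomRight (s g) ≈M proj₂ g)

    -- The 2-cocycle c_s of the section s is defined by
    --   s(g) s(g') = c_s(g,g') · s(g g'),   c_s(g,g') ∈ S_n.
    -- "c_s(g,g') = X" is the matrix identity s(g)s(g') = (I + X) s(gg').
    CocycleIs : (Gm → Mat n n) → (Gm → Gm → Mat m m) → Set
    CocycleIs s c = ∀ g g' → InG g → InG g' →
      (s g ·M s g') ≈M ((idM +M embedS (c g g')) ·M s (g ∙G g'))

    ExtensionClassIs : (Gm → Gm → Mat m m) → Set
    ExtensionClassIs z =
      Σ (Gm → Mat n n) λ s → IsSection s ×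
      Σ (Gm → Mat m m) λ f → CocycleIs s (λ g g' → z g g' +M δ f g g')

-- Write Fin n = Fin ((m + 1) + m) and lift g = (g₁, g₂) ∈ G to the block
-- matrix s(g) = [[g₁, C(g₂)], [0, π'(g₂)]], where C(g₂) vanishes except for
-- its last row ψ(g₂).  S_n is the top-right block above a zero row, so the
-- block product formula reduces s(g) s(g′) = (I + X) s(gg′) to one identity
-- of off-diagonal blocks.  Its first m rows read X π'(g₂h₂) = φ(g₁) ψ(h₂),
-- which holds for the cup product X = φ₁(g) (g · φ₂(g′)) since π' is
-- multiplicative and uinv inverts unitriangular matrices; its last row is
-- the crossed-homomorphism identity ψ(g₂h₂) = ψ(h₂) + ψ(g₂) π'(h₂).  Hence
-- the cocycle of s is the cup product itself (coboundary of the zero cochain).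

module Submission where

open import Defs
open import Data.Nat using (ℕ; NonZero; _≤_)
open import Data.Nat.Primality using (Prime)
import Data.Nat as ℕ
import Data.Nat.Properties as ℕ
open import Data.Nat.DivMod using (_mod_; _%_; %-distribˡ-+; %-distribˡ-*; m%n%n≡m%n; m<n⇒m%n≡m; n%n≡0; m*n%n≡0; m%n<n)
open import Data.Fin using (Fin; zero; suc; toℕ; inject₁; fromℕ; _↑ˡ_; _↑ʳ_; _≟_; splitAt; cast)
open import Data.Fin.Properties using (toℕ-injective; toℕ-fromℕ<; toℕ<n; toℕ-↑ˡ; toℕ-↑ʳ; ↑ˡ-injective; ↑ʳ-injective;
  splitAt-↑ˡ; splitAt-↑ʳ; splitAt⁻¹-↑ˡ; splitAt⁻¹-↑ʳ; toℕ-cast; toℕ-fromℕ; toℕ-inject₁)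
open import Data.Product using (_×_; _,_; proj₁; proj₂)
open import Data.Sum using (_⊎_; inj₁; inj₂)
open import Level using (0ℓ)
open import Relation.Binary.Bundles using (Setoid)
import Relation.Binary.Reasoning.Setoid as SetoidReasoning
open import Relation.Binary.PropositionalEquality using (_≡_; _≢_; refl; sym; trans; cong; cong₂; subst₂;
  isEquivalence; module ≡-Reasoning)
open import Relation.Nullary using (Dec; yes; no)
open import Relation.Nullary.Negation using (contradiction)
open import Algebra.Bundles using (CommutativeRing)
open import Algebra.Structures using (IsCommutativeRing)
open import Algebra.Consequences.Propositional using (comm∧idˡ⇒id; comm∧invʳ⇒inv; comm∧distrˡ⇒distrʳ)
import Algebra.Properties.Semiring.Sum as SemiringSum
import Algebra.Properties.AbelianGroup as AbelianGroupProperties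

module ResidueRing (p : ℕ) .{{_ : NonZero p}} where

  open ≡-Reasoning

  [_] : ℕ → F p
  [ x ] = x mod p

  toℕ-[] : ∀ x → toℕ [ x ] ≡ x % p
  toℕ-[] x = toℕ-fromℕ< (m%n<n x p)

  []-toℕ : ∀ (a : F p) → [ toℕ a ] ≡ a
  []-toℕ a = toℕ-injective (trans (toℕ-[] (toℕ a)) (m<n⇒m%n≡m (toℕ<n a)))

  []-cong-% : ∀ {x y} → x % p ≡ y % p → [ x ] ≡ [ y ]
  []-cong-% {x} {y} e = toℕ-injective (trans (toℕ-[] x) (trans e (sym (toℕ-[] y))))

  -- The field
  -- operations are reductions of ℕ-operations, so this is what makes
  -- the laws of ℕ descend to F p.
  module Absorb (_∙_ : ℕ → ℕ → ℕ)
                (compat : ∀ x y → (x ∙ y) % p ≡ ((x % p) ∙ (y % p)) % p) where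

    private
      reduce-twice : ∀ x → toℕ [ x ] % p ≡ x % p
      reduce-twice x = trans (cong (_% p) (toℕ-[] x)) (m%n%n≡m%n x p)

    absorbˡ : ∀ x y → [ toℕ [ x ] ∙ y ] ≡ [ x ∙ y ]
    absorbˡ x y = []-cong-% (begin
      (toℕ [ x ] ∙ y) % p            ≡⟨ compat (toℕ [ x ]) y ⟩
      ((toℕ [ x ] % p) ∙ (y % p)) % p ≡⟨ cong (λ t → (t ∙ (y % p)) % p) (reduce-twice x) ⟩
      ((x % p) ∙ (y % p)) % p         ≡⟨ compat x y ⟨
      (x ∙ y) % p                     ∎)

    absorbʳ : ∀ x y → [ x ∙ toℕ [ y ] ] ≡ [ x ∙ y ]
    absorbʳ x y = []-cong-% (begin
      (x ∙ toℕ [ y ]) % p            ≡⟨ compat x (toℕ [ y ]) ⟩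
      ((x % p) ∙ (toℕ [ y ] % p)) % p ≡⟨ cong (λ t → ((x % p) ∙ t) % p) (reduce-twice y) ⟩
      ((x % p) ∙ (y % p)) % p         ≡⟨ compat x y ⟨
      (x ∙ y) % p                     ∎)

  open Absorb ℕ._+_ (λ x y → %-distribˡ-+ x y p) renaming (absorbˡ to absorbˡ-+; absorbʳ to absorbʳ-+)
  open Absorb ℕ._*_ (λ x y → %-distribˡ-* x y p) renaming (absorbˡ to absorbˡ-*; absorbʳ to absorbʳ-*)

  private
    _+_ = _+F_ p
    _*_ = _*F_ p
    -_ = -F_ p

  +-assoc : ∀ a b c → (a + b) + c ≡ a + (b + c)
  +-assoc a b c = begin
    [ toℕ [ toℕ a ℕ.+ toℕ b ] ℕ.+ toℕ c ] ≡⟨ absorbˡ-+ _ _ ⟩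
    [ (toℕ a ℕ.+ toℕ b) ℕ.+ toℕ c ]       ≡⟨ cong [_] (ℕ.+-assoc (toℕ a) _ _) ⟩
    [ toℕ a ℕ.+ (toℕ b ℕ.+ toℕ c) ]       ≡⟨ absorbʳ-+ _ _ ⟨
    [ toℕ a ℕ.+ toℕ [ toℕ b ℕ.+ toℕ c ] ] ∎

  *-assoc : ∀ a b c → (a * b) * c ≡ a * (b * c)
  *-assoc a b c = begin
    [ toℕ [ toℕ a ℕ.* toℕ b ] ℕ.* toℕ c ] ≡⟨ absorbˡ-* _ _ ⟩
    [ (toℕ a ℕ.* toℕ b) ℕ.* toℕ c ]       ≡⟨ cong [_] (ℕ.*-assoc (toℕ a) _ _) ⟩
    [ toℕ a ℕ.* (toℕ b ℕ.* toℕ c) ]       ≡⟨ absorbʳ-* (toℕ a) _ ⟨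
    [ toℕ a ℕ.* toℕ [ toℕ b ℕ.* toℕ c ] ] ∎

  +-comm : ∀ a b → a + b ≡ b + a
  +-comm a b = cong [_] (ℕ.+-comm (toℕ a) (toℕ b))

  *-comm : ∀ a b → a * b ≡ b * a
  *-comm a b = cong [_] (ℕ.*-comm (toℕ a) (toℕ b))

  +-identityˡ : ∀ a → 0F p + a ≡ a
  +-identityˡ a = trans (absorbˡ-+ 0 (toℕ a)) ([]-toℕ a)

  *-identityˡ : ∀ a → 1F p * a ≡ a
  *-identityˡ a = trans (absorbˡ-* 1 (toℕ a)) (trans (cong [_] (ℕ.*-identityˡ (toℕ a))) ([]-toℕ a))

  -‿inverseʳ : ∀ a → a + (- a) ≡ 0F p
  -‿inverseʳ a = begin
    [ toℕ a ℕ.+ toℕ [ p ℕ.∸ toℕ a ] ] ≡⟨ absorbʳ-+ _ _ ⟩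
    [ toℕ a ℕ.+ (p ℕ.∸ toℕ a) ]       ≡⟨ cong [_] (ℕ.m+[n∸m]≡n (ℕ.<⇒≤ (toℕ<n a))) ⟩
    [ p ]                             ≡⟨ []-cong-% (trans (n%n≡0 p) (sym (m*n%n≡0 0 p))) ⟩
    [ 0 ]                             ∎

  *-distribˡ-+ : ∀ a b c → a * (b + c) ≡ (a * b) + (a * c)
  *-distribˡ-+ a b c = begin
    [ toℕ a ℕ.* toℕ [ toℕ b ℕ.+ toℕ c ] ]                 ≡⟨ absorbʳ-* (toℕ a) _ ⟩
    [ toℕ a ℕ.* (toℕ b ℕ.+ toℕ c) ]                       ≡⟨ cong [_] (ℕ.*-distribˡ-+ (toℕ a) _ _) ⟩
    [ toℕ a ℕ.* toℕ b ℕ.+ toℕ a ℕ.* toℕ c ]               ≡⟨ absorbˡ-+ _ _ ⟨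
    [ toℕ [ toℕ a ℕ.* toℕ b ] ℕ.+ toℕ a ℕ.* toℕ c ]       ≡⟨ absorbʳ-+ _ _ ⟨
    [ toℕ [ toℕ a ℕ.* toℕ b ] ℕ.+ toℕ [ toℕ a ℕ.* toℕ c ] ] ∎

  isCommutativeRing : IsCommutativeRing _≡_ _+_ _*_ -_ (0F p) (1F p)
  isCommutativeRing = record
    { isRing = record
      { +-isAbelianGroup = record
        { isGroup = record
          { isMonoid = record
            { isSemigroup = record
              { isMagma = record { isEquivalence = isEquivalence ; ∙-cong = cong₂ _+_ }
              ; assoc = +-assoc }
            ; identity = comm∧idˡ⇒id +-comm +-identityˡ }
          ; inverse = comm∧invʳ⇒inv +-comm -‿inverseʳ
          ; ⁻¹-cong = cong -_ }
        ; comm = +-comm }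
      ; *-cong = cong₂ _*_
      ; *-assoc = *-assoc
      ; *-identity = comm∧idˡ⇒id *-comm *-identityˡ
      ; distrib = *-distribˡ-+ , comm∧distrˡ⇒distrʳ *-comm *-distribˡ-+ }
    ; *-comm = *-comm }

  ring : CommutativeRing 0ℓ 0ℓ
  ring = record { isCommutativeRing = isCommutativeRing }

module Sums (p : ℕ) .{{_ : NonZero p}} where

  open CommutativeRing (ResidueRing.ring p) using (_+_; _*_; 0#; semiring; +-assoc; +-identityˡ; +-identityʳ)
  open SemiringSum semiring using (sum; sum-cong-≗; sum-replicate-zero; ∑-distrib-+; ∑-comm;
                                   *-distribˡ-sum; *-distribʳ-sum; sum-init-last)
  open ≡-Reasoning

  ΣF≡sum : ∀ {k} (f : Fin k → F p) → ΣF p f ≡ sum f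
  ΣF≡sum {ℕ.zero}  f = refl
  ΣF≡sum {ℕ.suc k} f = cong (f zero +_) (ΣF≡sum (λ i → f (suc i)))

  ΣF-cong : ∀ {k} {f g : Fin k → F p} → (∀ i → f i ≡ g i) → ΣF p f ≡ ΣF p g
  ΣF-cong {f = f} {g} f≗g = trans (ΣF≡sum f) (trans (sum-cong-≗ f≗g) (sym (ΣF≡sum g)))

  ΣF-zeros : ∀ {k} {f : Fin k → F p} → (∀ i → f i ≡ 0#) → ΣF p f ≡ 0#
  ΣF-zeros {k} {f} f≗0 = trans (ΣF-cong f≗0) (trans (ΣF≡sum {k} (λ _ → 0#)) (sum-replicate-zero k))

  ΣF-+ : ∀ {k} (f g : Fin k → F p) → ΣF p (λ i → f i + g i) ≡ ΣF p f + ΣF p g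
  ΣF-+ f g = begin
    ΣF p (λ i → f i + g i) ≡⟨ ΣF≡sum (λ i → f i + g i) ⟩
    sum (λ i → f i + g i)  ≡⟨ ∑-distrib-+ f g ⟩
    sum f + sum g          ≡⟨ cong₂ _+_ (ΣF≡sum f) (ΣF≡sum g) ⟨
    ΣF p f + ΣF p g        ∎

  ΣF-comm : ∀ {a b} (f : Fin a → Fin b → F p) →
            ΣF p (λ i → ΣF p (f i)) ≡ ΣF p (λ j → ΣF p (λ i → f i j))
  ΣF-comm f = begin
    ΣF p (λ i → ΣF p (f i))            ≡⟨ ΣF≡sum (λ i → ΣF p (f i)) ⟩
    sum (λ i → ΣF p (f i))             ≡⟨ sum-cong-≗ (λ i → ΣF≡sum (f i)) ⟩
    sum (λ i → sum (f i))              ≡⟨ ∑-comm f ⟩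
    sum (λ j → sum (λ i → f i j))      ≡⟨ sum-cong-≗ (λ j → ΣF≡sum (λ i → f i j)) ⟨
    sum (λ j → ΣF p (λ i → f i j))     ≡⟨ ΣF≡sum (λ j → ΣF p (λ i → f i j)) ⟨
    ΣF p (λ j → ΣF p (λ i → f i j))    ∎

  ΣF-*ˡ : ∀ {k} x (f : Fin k → F p) → x * ΣF p f ≡ ΣF p (λ i → x * f i)
  ΣF-*ˡ x f = trans (cong (x *_) (ΣF≡sum f)) (trans (*-distribˡ-sum x f) (sym (ΣF≡sum (λ i → x * f i))))

  ΣF-*ʳ : ∀ {k} x (f : Fin k → F p) → ΣF p f * x ≡ ΣF p (λ i → f i * x)
  ΣF-*ʳ x f = trans (cong (_* x) (ΣF≡sum f)) (trans (*-distribʳ-sum x f) (sym (ΣF≡sum (λ i → f i * x))))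

  ΣF-init-last : ∀ {k} (f : Fin (ℕ.suc k) → F p) → ΣF p f ≡ ΣF p (λ i → f (inject₁ i)) + f (fromℕ k)
  ΣF-init-last {k} f = trans (ΣF≡sum f) (trans (sum-init-last f) (cong (_+ f (fromℕ k)) (sym (ΣF≡sum (λ i → f (inject₁ i))))))

  ΣF-split : ∀ a {b} (f : Fin (a ℕ.+ b) → F p) →
             ΣF p f ≡ ΣF p (λ i → f (i ↑ˡ b)) + ΣF p (λ j → f (a ↑ʳ j))
  ΣF-split ℕ.zero    f = sym (+-identityˡ (ΣF p f))
  ΣF-split (ℕ.suc a) f = trans (cong (f zero +_) (ΣF-split a (λ i → f (suc i)))) (sym (+-assoc (f zero) _ _))

  ΣF-single : ∀ {k} (f : Fin k → F p) i → (∀ j → j ≢ i → f j ≡ 0#) → ΣF p f ≡ f i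
  ΣF-single f zero    off = trans (cong (f zero +_) (ΣF-zeros (λ j → off (suc j) λ ()))) (+-identityʳ _)
  ΣF-single f (suc i) off = begin
    f zero + ΣF p (λ j → f (suc j)) ≡⟨ cong₂ _+_ (off zero λ ()) (ΣF-single _ i λ j j≢i → off (suc j) (λ { refl → j≢i refl })) ⟩
    0# + f (suc i)                  ≡⟨ +-identityˡ _ ⟩
    f (suc i)                       ∎

module Matrices (p : ℕ) .{{_ : NonZero p}} where

  open CommutativeRing (ResidueRing.ring p) using (_+_; _*_; 0#; 1#;
    *-assoc; *-identityˡ; *-identityʳ; zeroˡ; zeroʳ; distribˡ; distribʳ)
  open Sums p
  open ≡-Reasoning

  infixl 7 _·_
  infixl 6 _⊕_
  infix  4 _≈_

  _·_ : ∀ {r k c} → Mat p r k → Mat p k c → Mat p r c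
  _·_ = _·M_ p

  _⊕_ : ∀ {r c} → Mat p r c → Mat p r c → Mat p r c
  _⊕_ = _+M_ p

  _≈_ : ∀ {r c} → Mat p r c → Mat p r c → Set
  _≈_ = _≈M_ p

  I : ∀ {k} → Mat p k k
  I = idM p

  O : ∀ {r c} → Mat p r c
  O = zeroM p

  ≈-setoid : ℕ → ℕ → Setoid 0ℓ 0ℓ
  ≈-setoid r c = record
    { Carrier       = Mat p r c
    ; _≈_           = _≈_
    ; isEquivalence = record
      { refl  = λ _ _ → refl
      ; sym   = λ e i j → sym (e i j)
      ; trans = λ e e′ i j → trans (e i j) (e′ i j) } }

  ≈-refl : ∀ {r c} {A : Mat p r c} → A ≈ A
  ≈-refl _ _ = refl

  ≈-sym : ∀ {r c} {A B : Mat p r c} → A ≈ B → B ≈ A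
  ≈-sym A≈B i j = sym (A≈B i j)

  ·-cong : ∀ {r k c} {A A′ : Mat p r k} {B B′ : Mat p k c} → A ≈ A′ → B ≈ B′ → A · B ≈ A′ · B′
  ·-cong A≈A′ B≈B′ i j = ΣF-cong (λ l → cong₂ _*_ (A≈A′ i l) (B≈B′ l j))

  ⊕-cong : ∀ {r c} {A A′ B B′ : Mat p r c} → A ≈ A′ → B ≈ B′ → A ⊕ B ≈ A′ ⊕ B′
  ⊕-cong A≈A′ B≈B′ i j = cong₂ _+_ (A≈A′ i j) (B≈B′ i j)

  ·-assoc : ∀ {r a b c} (A : Mat p r a) (B : Mat p a b) (C : Mat p b c) → (A · B) · C ≈ A · (B · C)
  ·-assoc A B C i j = begin
    ΣF p (λ l → ΣF p (λ k → A i k * B k l) * C l j)   ≡⟨ ΣF-cong (λ l → ΣF-*ʳ (C l j) (λ k → A i k * B k l)) ⟩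
    ΣF p (λ l → ΣF p (λ k → (A i k * B k l) * C l j)) ≡⟨ ΣF-comm (λ l k → (A i k * B k l) * C l j) ⟩
    ΣF p (λ k → ΣF p (λ l → (A i k * B k l) * C l j)) ≡⟨ ΣF-cong (λ k → ΣF-cong (λ l → *-assoc (A i k) (B k l) (C l j))) ⟩
    ΣF p (λ k → ΣF p (λ l → A i k * (B k l * C l j))) ≡⟨ ΣF-cong (λ k → ΣF-*ˡ (A i k) (λ l → B k l * C l j)) ⟨
    ΣF p (λ k → A i k * ΣF p (λ l → B k l * C l j))   ∎

  ·-distribˡ : ∀ {r k c} (A : Mat p r k) (B C : Mat p k c) → A · (B ⊕ C) ≈ A · B ⊕ A · C
  ·-distribˡ A B C i j = trans (ΣF-cong (λ l → distribˡ (A i l) (B l j) (C l j))) (ΣF-+ (λ l → A i l * B l j) (λ l → A i l * C l j))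

  ·-distribʳ : ∀ {r k c} (A B : Mat p r k) (C : Mat p k c) → (A ⊕ B) · C ≈ A · C ⊕ B · C
  ·-distribʳ A B C i j = trans (ΣF-cong (λ l → distribʳ (C l j) (A i l) (B i l))) (ΣF-+ (λ l → A i l * C l j) (λ l → B i l * C l j))

  ·-zeroˡ : ∀ {r k c} (A : Mat p k c) → O {r} · A ≈ O
  ·-zeroˡ A i j = ΣF-zeros (λ l → zeroˡ (A l j))

  ·-zeroʳ : ∀ {r k c} (A : Mat p r k) → A · O {k} {c} ≈ O
  ·-zeroʳ A i j = ΣF-zeros (λ l → zeroʳ (A i l))

  idM-diag : ∀ {k} (i : Fin k) → I i i ≡ 1#
  idM-diag i with i ≟ i
  ... | yes _   = refl
  ... | no  i≢i = contradiction refl i≢i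

  idM-off : ∀ {k} {i j : Fin k} → i ≢ j → I i j ≡ 0#
  idM-off {i = i} {j} i≢j with i ≟ j
  ... | yes i≡j = contradiction i≡j i≢j
  ... | no  _   = refl

  idM-reindex : ∀ {k l} {f : Fin k → Fin l} → (∀ {x y} → f x ≡ f y → x ≡ y) →
                ∀ x y → I (f x) (f y) ≡ I x y
  idM-reindex {f = f} f-inj x y = by-cases (x ≟ y)
    where
    by-cases : Dec (x ≡ y) → I (f x) (f y) ≡ I x y
    by-cases (yes refl) = trans (idM-diag (f x)) (sym (idM-diag x))
    by-cases (no  x≢y)  = trans (idM-off (λ e → x≢y (f-inj e))) (sym (idM-off x≢y))

  ·-identityˡ : ∀ {r c} (A : Mat p r c) → I · A ≈ A
  ·-identityˡ A i j = begin
    ΣF p (λ l → I i l * A l j) ≡⟨ ΣF-single _ i (λ l l≢i → trans (cong (_* A l j) (idM-off (λ i≡l → l≢i (sym i≡l)))) (zeroˡ _)) ⟩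
    I i i * A i j              ≡⟨ cong (_* A i j) (idM-diag i) ⟩
    1# * A i j                 ≡⟨ *-identityˡ _ ⟩
    A i j                      ∎

  ·-identityʳ : ∀ {r c} (A : Mat p r c) → A · I ≈ A
  ·-identityʳ A i j = begin
    ΣF p (λ l → A i l * I l j) ≡⟨ ΣF-single _ j (λ l l≢j → trans (cong (A i l *_) (idM-off l≢j)) (zeroʳ (A i l))) ⟩
    A i j * I j j              ≡⟨ cong (A i j *_) (idM-diag j) ⟩
    A i j * 1#                 ≡⟨ *-identityʳ _ ⟩
    A i j                      ∎

-- A unitriangular matrix A has left inverse uinv A = Σ_{e<k} (I - A)^e:
-- the geometric sum telescopes against A = I - N, and N = I - A is
-- strictly upper triangular, hence N^k = 0.
module Unitriangular (p : ℕ) .{{_ : NonZero p}} where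

  open CommutativeRing (ResidueRing.ring p) using (_+_; _*_; -_; 0#; 1#; +-identityˡ; +-identityʳ;
    +-assoc; -‿inverseʳ; zeroˡ; zeroʳ; +-abelianGroup)
  open AbelianGroupProperties +-abelianGroup using (xyx⁻¹≈y)
  open Sums p
  open Matrices p

  StrictlyUpper : ∀ {k} → Mat p k k → Set
  StrictlyUpper N = ∀ i j → toℕ j ℕ.≤ toℕ i → N i j ≡ 0#

  -- (N^t)ᵢⱼ = 0 whenever j < i + t: each factor N moves at least one step
  -- above the diagonal.
  pow-vanishes : ∀ {k} {N : Mat p k k} → StrictlyUpper N →
                 ∀ t i j → toℕ j ℕ.< toℕ i ℕ.+ t → powM p N t i j ≡ 0#
  pow-vanishes {N = N} upper ℕ.zero i j j<i+0 =
    idM-off {i = i} {j} (λ { refl → ℕ.<-irrefl refl (ℕ.<-≤-trans j<i+0 (ℕ.≤-reflexive (ℕ.+-identityʳ (toℕ i)))) })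
  pow-vanishes {N = N} upper (ℕ.suc t) i j j<i+1+t = ΣF-zeros {f = λ l → N i l * powM p N t l j} term-vanishes
    where
    term-vanishes : ∀ l → N i l * powM p N t l j ≡ 0#
    term-vanishes l with toℕ l ℕ.≤? toℕ i
    ... | yes l≤i = trans (cong (_* powM p N t l j) (upper i l l≤i)) (zeroˡ (powM p N t l j))
    ... | no  l≰i = trans (cong (N i l *_) (pow-vanishes upper t l j j<l+t)) (zeroʳ (N i l))
      where
      j<l+t : toℕ j ℕ.< toℕ l ℕ.+ t
      j<l+t = ℕ.<-≤-trans (ℕ.≤-trans j<i+1+t (ℕ.≤-reflexive (ℕ.+-suc (toℕ i) t)))
                          (ℕ.+-monoˡ-≤ t (ℕ.≰⇒> l≰i))

  nilpotent : ∀ {k} {N : Mat p k k} → StrictlyUpper N → powM p N k ≈ O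
  nilpotent {k} upper i j = pow-vanishes upper k i j (ℕ.<-≤-trans (toℕ<n j) (ℕ.m≤n+m k (toℕ i)))

  unitri⇒strictlyUpper : ∀ {k} {A : Mat p k k} → IsUnitri p A → StrictlyUpper (I ⊕ -M_ p A)
  unitri⇒strictlyUpper {A = A} unitri i j j≤i with ℕ.m≤n⇒m<n∨m≡n j≤i
  ... | inj₁ j<i = begin
    I i j + - A i j ≡⟨ cong₂ _+_ (idM-off {i = i} {j} (λ { refl → ℕ.<-irrefl refl j<i })) (cong -_ (proj₁ (unitri i j) j<i)) ⟩
    0# + - 0#       ≡⟨ -‿inverseʳ 0# ⟩
    0#              ∎
    where open ≡-Reasoning
  ... | inj₂ j≡i with toℕ-injective j≡i
  ... | refl = begin
    I j j + - A j j ≡⟨ cong₂ _+_ (idM-diag j) (cong -_ (proj₂ (unitri j j) refl)) ⟩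
    1# + - 1#       ≡⟨ -‿inverseʳ 1# ⟩
    0#              ∎
    where open ≡-Reasoning

  pow-comm : ∀ {k} (N : Mat p k k) t → N · powM p N t ≈ powM p N t · N
  pow-comm N ℕ.zero    = λ i j → trans (·-identityʳ N i j) (sym (·-identityˡ N i j))
  pow-comm N (ℕ.suc t) = begin
    N · (N · P) ≈⟨ ·-cong {A = N} ≈-refl (pow-comm N t) ⟩
    N · (P · N) ≈⟨ ·-assoc N P N ⟨
    N · P · N   ∎
    where
    P : Mat p _ _
    P = powM p N t
    open SetoidReasoning (≈-setoid _ _)

  telescope : ∀ {k} (A : Mat p k k) t →
              geomM p (I ⊕ -M_ p A) t · A ⊕ powM p (I ⊕ -M_ p A) t ≈ I
  telescope A ℕ.zero    i j = trans (cong (_+ I i j) (·-zeroˡ A i j)) (+-identityˡ (I i j))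
  telescope A (ℕ.suc t) = begin
    (G ⊕ P) · A ⊕ N · P       ≈⟨ ⊕-cong (·-distribʳ G P A) (pow-comm N t) ⟩
    (G · A ⊕ P · A) ⊕ P · N   ≈⟨ (λ i j → +-assoc ((G · A) i j) ((P · A) i j) ((P · N) i j)) ⟩
    G · A ⊕ (P · A ⊕ P · N)   ≈⟨ ⊕-cong {A = G · A} ≈-refl (·-distribˡ P A N) ⟨
    G · A ⊕ P · (A ⊕ N)       ≈⟨ ⊕-cong {A = G · A} ≈-refl (·-cong {A = P} ≈-refl A⊕N≈I) ⟩
    G · A ⊕ P · I             ≈⟨ ⊕-cong {A = G · A} ≈-refl (·-identityʳ P) ⟩
    G · A ⊕ P                 ≈⟨ telescope A t ⟩
    I                         ∎
    where
    N G P : Mat p _ _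
    N = I ⊕ -M_ p A
    G = geomM p N t
    P = powM p N t
    A⊕N≈I : A ⊕ N ≈ I
    A⊕N≈I i j = trans (sym (+-assoc (A i j) (I i j) (- A i j))) (xyx⁻¹≈y (A i j) (I i j))
    open SetoidReasoning (≈-setoid _ _)

  uinv-inverseˡ : ∀ {k} {A : Mat p k k} → IsUnitri p A → uinv p A · A ≈ I
  uinv-inverseˡ {k} {A} unitri i j = begin
    (uinv p A · A) i j                     ≡⟨ +-identityʳ _ ⟨
    (uinv p A · A) i j + 0#                ≡⟨ cong ((uinv p A · A) i j +_) (nilpotent (unitri⇒strictlyUpper unitri) i j) ⟨
    (uinv p A · A) i j + powM p N k i j    ≡⟨ telescope A k i j ⟩
    I i j                                  ∎
    where
    N : Mat p k k
    N = I ⊕ -M_ p A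
    open ≡-Reasoning

  uinv-cancelˡ : ∀ {k r} {A : Mat p k k} → IsUnitri p A → (B : Mat p k r) → uinv p A · (A · B) ≈ B
  uinv-cancelˡ {A = A} unitri B = begin
    uinv p A · (A · B) ≈⟨ ·-assoc (uinv p A) A B ⟨
    uinv p A · A · B   ≈⟨ ·-cong (uinv-inverseˡ unitri) ≈-refl ⟩
    I · B              ≈⟨ ·-identityˡ B ⟩
    B                  ∎
    where open SetoidReasoning (≈-setoid _ _)

module Blocks (p : ℕ) .{{_ : NonZero p}} where

  open CommutativeRing (ResidueRing.ring p) using (_+_; _*_; 0#; 1#; +-identityˡ; +-identityʳ; zeroˡ; zeroʳ)
  open Sums p
  open Matrices p

  blk : ∀ {a b} → Mat p a a → Mat p a b → Mat p b b → Mat p (a ℕ.+ b) (a ℕ.+ b)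
  blk {a} {b} A B D i j = entry (splitAt a i) (splitAt a j)
    where
    entry : Fin a ⊎ Fin b → Fin a ⊎ Fin b → F p
    entry (inj₁ x) (inj₁ y) = A x y
    entry (inj₁ x) (inj₂ y) = B x y
    entry (inj₂ x) (inj₁ y) = 0#
    entry (inj₂ x) (inj₂ y) = D x y

  data Side (a b : ℕ) : Fin (a ℕ.+ b) → Set where
    first  : (x : Fin a) → Side a b (x ↑ˡ b)
    second : (y : Fin b) → Side a b (a ↑ʳ y)

  side : ∀ a {b} (i : Fin (a ℕ.+ b)) → Side a b i
  side a i with splitAt a i in eq
  ... | inj₁ x with refl ← splitAt⁻¹-↑ˡ eq = first x
  ... | inj₂ y with refl ← splitAt⁻¹-↑ʳ eq = second y

  first<second : ∀ {a b} (x : Fin a) (y : Fin b) → toℕ (x ↑ˡ b) ℕ.< toℕ (a ↑ʳ y)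
  first<second {a} {b} x y rewrite toℕ-↑ˡ x b | toℕ-↑ʳ a y = ℕ.<-≤-trans (toℕ<n x) (ℕ.m≤m+n a (toℕ y))

  module _ {a b} (A : Mat p a a) (B : Mat p a b) (D : Mat p b b) where

    blk-ff : ∀ x y → blk A B D (x ↑ˡ b) (y ↑ˡ b) ≡ A x y
    blk-ff x y rewrite splitAt-↑ˡ a x b | splitAt-↑ˡ a y b = refl

    blk-fs : ∀ x y → blk A B D (x ↑ˡ b) (a ↑ʳ y) ≡ B x y
    blk-fs x y rewrite splitAt-↑ˡ a x b | splitAt-↑ʳ a b y = refl

    blk-sf : ∀ x y → blk A B D (a ↑ʳ x) (y ↑ˡ b) ≡ 0#
    blk-sf x y rewrite splitAt-↑ʳ a b x | splitAt-↑ˡ a y b = refl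

    blk-ss : ∀ x y → blk A B D (a ↑ʳ x) (a ↑ʳ y) ≡ D x y
    blk-ss x y rewrite splitAt-↑ʳ a b x | splitAt-↑ʳ a b y = refl

  blk-cong : ∀ {a b} {A A′ : Mat p a a} {B B′ : Mat p a b} {D D′ : Mat p b b} →
             A ≈ A′ → B ≈ B′ → D ≈ D′ → blk A B D ≈ blk A′ B′ D′
  blk-cong {a} A≈A′ B≈B′ D≈D′ i j with splitAt a i | splitAt a j
  ... | inj₁ x | inj₁ y = A≈A′ x y
  ... | inj₁ x | inj₂ y = B≈B′ x y
  ... | inj₂ x | inj₁ y = refl
  ... | inj₂ x | inj₂ y = D≈D′ x y

  blk-⊕ : ∀ {a b} (A A′ : Mat p a a) (B B′ : Mat p a b) (D D′ : Mat p b b) →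
          blk A B D ⊕ blk A′ B′ D′ ≈ blk (A ⊕ A′) (B ⊕ B′) (D ⊕ D′)
  blk-⊕ {a} A A′ B B′ D D′ i j with splitAt a i | splitAt a j
  ... | inj₁ x | inj₁ y = refl
  ... | inj₁ x | inj₂ y = refl
  ... | inj₂ x | inj₁ y = +-identityˡ 0#
  ... | inj₂ x | inj₂ y = refl

  blk-· : ∀ {a b} (A A′ : Mat p a a) (B B′ : Mat p a b) (D D′ : Mat p b b) →
          blk A B D · blk A′ B′ D′ ≈ blk (A · A′) (A · B′ ⊕ B · D′) (D · D′)
  blk-· {a} {b} A A′ B B′ D D′ i j =
    trans (ΣF-split a (λ l → M i l * M′ l j)) (by-blocks (side a i) (side a j))
    where
    M M′ P : Mat p (a ℕ.+ b) (a ℕ.+ b)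
    M  = blk A B D
    M′ = blk A′ B′ D′
    P  = blk (A · A′) (A · B′ ⊕ B · D′) (D · D′)
    open ≡-Reasoning

    by-blocks : ∀ {i j} → Side a b i → Side a b j →
                ΣF p (λ l → M i (l ↑ˡ b) * M′ (l ↑ˡ b) j) + ΣF p (λ l → M i (a ↑ʳ l) * M′ (a ↑ʳ l) j) ≡ P i j
    by-blocks (first x) (first y) = begin
      ΣF p (λ l → M (x ↑ˡ b) (l ↑ˡ b) * M′ (l ↑ˡ b) (y ↑ˡ b)) + ΣF p (λ l → M (x ↑ˡ b) (a ↑ʳ l) * M′ (a ↑ʳ l) (y ↑ˡ b))
        ≡⟨ cong₂ _+_ (ΣF-cong (λ l → cong₂ _*_ (blk-ff A B D x l) (blk-ff A′ B′ D′ l y)))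
                     (ΣF-zeros (λ l → trans (cong (M (x ↑ˡ b) (a ↑ʳ l) *_) (blk-sf A′ B′ D′ l y)) (zeroʳ (M (x ↑ˡ b) (a ↑ʳ l))))) ⟩
      (A · A′) x y + 0# ≡⟨ +-identityʳ _ ⟩
      (A · A′) x y      ≡⟨ blk-ff (A · A′) (A · B′ ⊕ B · D′) (D · D′) x y ⟨
      P (x ↑ˡ b) (y ↑ˡ b) ∎
    by-blocks (first x) (second y) = begin
      ΣF p (λ l → M (x ↑ˡ b) (l ↑ˡ b) * M′ (l ↑ˡ b) (a ↑ʳ y)) + ΣF p (λ l → M (x ↑ˡ b) (a ↑ʳ l) * M′ (a ↑ʳ l) (a ↑ʳ y))
        ≡⟨ cong₂ _+_ (ΣF-cong (λ l → cong₂ _*_ (blk-ff A B D x l) (blk-fs A′ B′ D′ l y)))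
                     (ΣF-cong (λ l → cong₂ _*_ (blk-fs A B D x l) (blk-ss A′ B′ D′ l y))) ⟩
      (A · B′ ⊕ B · D′) x y ≡⟨ blk-fs (A · A′) (A · B′ ⊕ B · D′) (D · D′) x y ⟨
      P (x ↑ˡ b) (a ↑ʳ y)   ∎
    by-blocks (second x) (first y) = begin
      ΣF p (λ l → M (a ↑ʳ x) (l ↑ˡ b) * M′ (l ↑ˡ b) (y ↑ˡ b)) + ΣF p (λ l → M (a ↑ʳ x) (a ↑ʳ l) * M′ (a ↑ʳ l) (y ↑ˡ b))
        ≡⟨ cong₂ _+_ (ΣF-zeros (λ l → trans (cong (_* M′ (l ↑ˡ b) (y ↑ˡ b)) (blk-sf A B D x l)) (zeroˡ _)))
                     (ΣF-zeros (λ l → trans (cong (M (a ↑ʳ x) (a ↑ʳ l) *_) (blk-sf A′ B′ D′ l y)) (zeroʳ (M (a ↑ʳ x) (a ↑ʳ l))))) ⟩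
      0# + 0#             ≡⟨ +-identityˡ 0# ⟩
      0#                  ≡⟨ blk-sf (A · A′) (A · B′ ⊕ B · D′) (D · D′) x y ⟨
      P (a ↑ʳ x) (y ↑ˡ b) ∎
    by-blocks (second x) (second y) = begin
      ΣF p (λ l → M (a ↑ʳ x) (l ↑ˡ b) * M′ (l ↑ˡ b) (a ↑ʳ y)) + ΣF p (λ l → M (a ↑ʳ x) (a ↑ʳ l) * M′ (a ↑ʳ l) (a ↑ʳ y))
        ≡⟨ cong₂ _+_ (ΣF-zeros (λ l → trans (cong (_* M′ (l ↑ˡ b) (a ↑ʳ y)) (blk-sf A B D x l)) (zeroˡ _)))
                     (ΣF-cong (λ l → cong₂ _*_ (blk-ss A B D x l) (blk-ss A′ B′ D′ l y))) ⟩
      0# + (D · D′) x y   ≡⟨ +-identityˡ _ ⟩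
      (D · D′) x y        ≡⟨ blk-ss (A · A′) (A · B′ ⊕ B · D′) (D · D′) x y ⟨
      P (a ↑ʳ x) (a ↑ʳ y) ∎

  first≢second : ∀ {a b} (x : Fin a) (y : Fin b) → x ↑ˡ b ≢ a ↑ʳ y
  first≢second x y e = ℕ.<-irrefl (cong toℕ e) (first<second x y)

  idM-blk : ∀ {a b} → I ≈ blk {a} {b} I O I
  idM-blk {a} {b} i j = by-blocks (side a i) (side a j)
    where
    by-blocks : ∀ {i j} → Side a b i → Side a b j → I i j ≡ blk {a} {b} I O I i j
    by-blocks (first x)  (first y)  = trans (idM-reindex (↑ˡ-injective b _ _) x y) (sym (blk-ff I O I x y))
    by-blocks (first x)  (second y) = trans (idM-off (first≢second x y)) (sym (blk-fs I O I x y))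
    by-blocks (second x) (first y)  = trans (idM-off (λ e → first≢second y x (sym e))) (sym (blk-sf I O I x y))
    by-blocks (second x) (second y) = trans (idM-reindex (↑ʳ-injective a _ _) x y) (sym (blk-ss {a} {b} I O I x y))

  blk-unitri : ∀ {a b} {A : Mat p a a} {D : Mat p b b} (B : Mat p a b) →
               IsUnitri p A → IsUnitri p D → IsUnitri p (blk A B D)
  blk-unitri {a} {b} {A} {D} B A-unitri D-unitri i j = by-blocks (side a i) (side a j)
    where
    M : Mat p (a ℕ.+ b) (a ℕ.+ b)
    M = blk A B D
    by-blocks : ∀ {i j} → Side a b i → Side a b j →
                (toℕ j ℕ.< toℕ i → M i j ≡ 0#) × (i ≡ j → M i j ≡ 1#)
    by-blocks (first x) (first y) =
        (λ y<x → trans (blk-ff A B D x y) (proj₁ (A-unitri x y) (subst₂ ℕ._<_ (toℕ-↑ˡ y b) (toℕ-↑ˡ x b) y<x)))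
      , (λ x≡y → trans (blk-ff A B D x y) (proj₂ (A-unitri x y) (↑ˡ-injective b x y x≡y)))
    by-blocks (first x) (second y) =
        (λ y<x → contradiction (first<second x y) (ℕ.<-asym y<x))
      , (λ x≡y → contradiction x≡y (first≢second x y))
    by-blocks (second x) (first y) =
        (λ _ → blk-sf A B D x y)
      , (λ x≡y → contradiction (sym x≡y) (first≢second y x))
    by-blocks (second x) (second y) =
        (λ y<x → trans (blk-ss A B D x y) (proj₁ (D-unitri x y)
                   (ℕ.+-cancelˡ-< a _ _ (subst₂ ℕ._<_ (toℕ-↑ʳ a y) (toℕ-↑ʳ a x) y<x))))
      , (λ x≡y → trans (blk-ss A B D x y) (proj₂ (D-unitri x y) (↑ʳ-injective a x y x≡y)))

  shear : ∀ {a b} (X : Mat p a b) (A : Mat p a a) (B : Mat p a b) (D : Mat p b b) →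
          (I ⊕ blk O X O) · blk A B D ≈ blk A (B ⊕ X · D) D
  shear {a} {b} X A B D = begin
    (I ⊕ blk O X O) · blk A B D             ≈⟨ ·-cong (⊕-cong (idM-blk {a} {b}) ≈-refl) ≈-refl ⟩
    (blk {a} {b} I O I ⊕ blk O X O) · blk A B D ≈⟨ ·-cong (blk-⊕ {a} {b} I O O X I O) ≈-refl ⟩
    blk (I ⊕ O) (O ⊕ X) (I ⊕ O) · blk A B D ≈⟨ ·-cong (blk-cong (λ i j → +-identityʳ (I i j)) (λ i j → +-identityˡ (X i j))
                                                            (λ i j → +-identityʳ (I i j))) ≈-refl ⟩
    blk I X I · blk A B D                   ≈⟨ blk-· I A X B I D ⟩
    blk (I · A) (I · B ⊕ X · D) (I · D)     ≈⟨ blk-cong (·-identityˡ A) (⊕-cong (·-identityˡ B) ≈-refl) (·-identityˡ D) ⟩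
    blk A (B ⊕ X · D) D                     ∎
    where open SetoidReasoning (≈-setoid _ _)

module LastRow (p : ℕ) .{{_ : NonZero p}} where

  open CommutativeRing (ResidueRing.ring p) using (_+_; _*_; 0#; +-identityˡ; zeroʳ)
  open Sums p
  open Matrices p
  open ≡-Reasoning

  withLastRow : ∀ {k c} → Mat p k c → (Fin c → F p) → Mat p (ℕ.suc k) c
  withLastRow {ℕ.zero}  X r zero    = r
  withLastRow {ℕ.suc k} X r zero    = X zero
  withLastRow {ℕ.suc k} X r (suc i) = withLastRow (λ i → X (suc i)) r i

  withLastRow-inject₁ : ∀ {k c} (X : Mat p k c) r i → withLastRow X r (inject₁ i) ≡ X i
  withLastRow-inject₁ {ℕ.suc k} X r zero    = refl
  withLastRow-inject₁ {ℕ.suc k} X r (suc i) = withLastRow-inject₁ (λ i → X (suc i)) r i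

  withLastRow-last : ∀ {k c} (X : Mat p k c) r → withLastRow X r (fromℕ k) ≡ r
  withLastRow-last {ℕ.zero}  X r = refl
  withLastRow-last {ℕ.suc k} X r = withLastRow-last (λ i → X (suc i)) r

  rows-ext : ∀ {k c} {M M′ : Mat p (ℕ.suc k) c} →
             (∀ i j → M (inject₁ i) j ≡ M′ (inject₁ i) j) → (∀ j → M (fromℕ k) j ≡ M′ (fromℕ k) j) → M ≈ M′
  rows-ext {ℕ.zero}  upper last zero    = last
  rows-ext {ℕ.suc k} upper last zero    = upper zero
  rows-ext {ℕ.suc k} upper last (suc i) = rows-ext (λ i → upper (suc i)) last i

  withLastRow-· : ∀ {k c d} (X : Mat p k c) r (B : Mat p c d) →
                  withLastRow X r · B ≈ withLastRow (X · B) (λ j → ΣF p (λ l → r l * B l j))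
  withLastRow-· {k} X r B = rows-ext
    (λ i j → trans (ΣF-cong (λ l → cong (λ row → row l * B l j) (withLastRow-inject₁ X r i)))
                   (sym (cong (λ row → row j) (withLastRow-inject₁ (X · B) (λ j → ΣF p (λ l → r l * B l j)) i))))
    (λ j → trans (ΣF-cong (λ l → cong (λ row → row l * B l j) (withLastRow-last X r)))
                 (sym (cong (λ row → row j) (withLastRow-last (X · B) (λ j → ΣF p (λ l → r l * B l j))))))

  ·-lastRowOnly : ∀ {r k c} (M : Mat p r (ℕ.suc k)) (s : Fin c → F p) →
                  M · withLastRow O s ≈ (λ i j → M i (fromℕ k) * s j)
  ·-lastRowOnly {k = k} M s i j = begin
    ΣF p (λ l → M i l * R l j)                                       ≡⟨ ΣF-init-last (λ l → M i l * R l j) ⟩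
    ΣF p (λ l → M i (inject₁ l) * R (inject₁ l) j) + M i (fromℕ k) * R (fromℕ k) j
      ≡⟨ cong₂ _+_ (ΣF-zeros (λ l → trans (cong (λ row → M i (inject₁ l) * row j) (withLastRow-inject₁ (O {k}) s l))
                                          (zeroʳ (M i (inject₁ l)))))
                   (cong (λ row → M i (fromℕ k) * row j) (withLastRow-last (O {k}) s)) ⟩
    0# + M i (fromℕ k) * s j                                         ≡⟨ +-identityˡ _ ⟩
    M i (fromℕ k) * s j                                              ∎
    where
    R : Mat p (ℕ.suc k) _
    R = withLastRow (O {k}) s

module Extension (p : ℕ) .{{_ : NonZero p}} (m : ℕ) where

  open Setting p m
  open CommutativeRing (ResidueRing.ring p) using (_+_; _*_; -_; 0#; 1#; +-identityˡ; +-identityʳ;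
    -‿inverseʳ; *-assoc; *-identityˡ; zeroˡ)
  open Sums p
  open Matrices p
  open Unitriangular p
  open Blocks p
  open LastRow p

  private
    last : Fin (ℕ.suc m)
    last = fromℕ m

  π'-unitri : ∀ {g} → IsUnitri p g → IsUnitri p (π' g)
  π'-unitri unitri i j = (λ j<i → proj₁ (unitri (suc i) (suc j)) (ℕ.s≤s j<i))
                       , (λ i≡j → proj₂ (unitri (suc i) (suc j)) (cong suc i≡j))

  -- Deleting the first row and column is multiplicative on U_{m+1},
  -- since the first column of a unitriangular g vanishes below the corner.
  π'-· : ∀ {g} h → IsUnitri p g → π' (g · h) ≈ π' g · π' h
  π'-· {g} h unitri a c = begin
    g (suc a) zero * h zero (suc c) + (π' g · π' h) a c ≡⟨ cong (λ x → x * h zero (suc c) + (π' g · π' h) a c)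
                                                                (proj₁ (unitri (suc a) zero) (ℕ.s≤s ℕ.z≤n)) ⟩
    0# * h zero (suc c) + (π' g · π' h) a c            ≡⟨ cong (_+ (π' g · π' h) a c) (zeroˡ (h zero (suc c))) ⟩
    0# + (π' g · π' h) a c                             ≡⟨ +-identityˡ _ ⟩
    (π' g · π' h) a c                                  ∎
    where open ≡-Reasoning

  ψ-· : ∀ {g} h → IsUnitri p g → ∀ c → ψ (g · h) c ≡ ψ h c + (ψ g ᵣ· π' h) c
  ψ-· {g} h unitri c =
    cong (_+ (ψ g ᵣ· π' h) c) (trans (cong (_* ψ h c) (proj₂ (unitri zero zero) refl)) (*-identityˡ (ψ h c)))

  -- Row vectors r are 1×m matrices; _ᵣ·_ is matrix multiplication.
  ᵣ·-assoc : ∀ r (A B : Mat p m m) j → ((r ᵣ· A) ᵣ· B) j ≡ (r ᵣ· (A · B)) j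
  ᵣ·-assoc r A B j = ·-assoc {1} (λ _ → r) A B zero j

  ᵣ·-cong : ∀ r {A B : Mat p m m} → A ≈ B → ∀ j → (r ᵣ· A) j ≡ (r ᵣ· B) j
  ᵣ·-cong r A≈B j = ·-cong {1} {A = λ _ → r} ≈-refl A≈B zero j

  ᵣ·-identity : ∀ r j → (r ᵣ· I) j ≡ r j
  ᵣ·-identity r j = ·-identityʳ {1} (λ _ → r) zero j

  -- The twisted cocycle g · φ₂(g′), multiplied back by π'(g₂h₂), is ψ(h₂):
  -- it equals ψ(h₂) π'(h₂)⁻¹ π'(g₂)⁻¹ and π'(g₂h₂) = π'(g₂) π'(h₂).
  twisted-φ₂ : ∀ g₁ h₁ {g₂ h₂} → IsUnitri p g₂ → IsUnitri p h₂ →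
               ∀ j → (actV* (g₁ , g₂) (φ₂ (h₁ , h₂)) ᵣ· π' (g₂ · h₂)) j ≡ ψ h₂ j
  twisted-φ₂ g₁ h₁ {g₂} {h₂} g₂-unitri h₂-unitri j = begin
    (w ᵣ· π' (g₂ · h₂)) j    ≡⟨ ᵣ·-cong w (π'-· h₂ g₂-unitri) j ⟩
    (w ᵣ· (P · Q)) j         ≡⟨ ᵣ·-assoc (ψ h₂ ᵣ· Q⁻¹) P⁻¹ (P · Q) j ⟩
    ((ψ h₂ ᵣ· Q⁻¹) ᵣ· (P⁻¹ · (P · Q))) j ≡⟨ ᵣ·-cong (ψ h₂ ᵣ· Q⁻¹) (uinv-cancelˡ (π'-unitri g₂-unitri) Q) j ⟩
    ((ψ h₂ ᵣ· Q⁻¹) ᵣ· Q) j   ≡⟨ ᵣ·-assoc (ψ h₂) Q⁻¹ Q j ⟩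
    (ψ h₂ ᵣ· (Q⁻¹ · Q)) j    ≡⟨ ᵣ·-cong (ψ h₂) (uinv-inverseˡ (π'-unitri h₂-unitri)) j ⟩
    (ψ h₂ ᵣ· I) j            ≡⟨ ᵣ·-identity (ψ h₂) j ⟩
    ψ h₂ j                   ∎
    where
    P Q P⁻¹ Q⁻¹ : Mat p m m
    P = π' g₂
    Q = π' h₂
    P⁻¹ = uinv p P
    Q⁻¹ = uinv p Q
    w : Fin m → F p
    w = (ψ h₂ ᵣ· Q⁻¹) ᵣ· P⁻¹
    open ≡-Reasoning

  pair-· : ∀ v r (B : Mat p m m) a b → (pair v r · B) a b ≡ v a * (r ᵣ· B) b
  pair-· v r B a b = begin
    ΣF p (λ l → (v a * r l) * B l b) ≡⟨ ΣF-cong (λ l → *-assoc (v a) (r l) (B l b)) ⟩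
    ΣF p (λ l → v a * (r l * B l b)) ≡⟨ ΣF-*ˡ (v a) (λ l → r l * B l b) ⟨
    v a * (r ᵣ· B) b                 ∎
    where open ≡-Reasoning

  cup-· : ∀ g₁ h₁ {g₂ h₂} → IsUnitri p g₂ → IsUnitri p h₂ →
          cup (g₁ , g₂) (h₁ , h₂) · π' (g₂ · h₂) ≈ pair (φ g₁) (ψ h₂)
  cup-· g₁ h₁ {g₂} {h₂} g₂-unitri h₂-unitri a b =
    trans (pair-· (φ g₁) _ (π' (g₂ · h₂)) a b) (cong (φ g₁ a *_) (twisted-φ₂ g₁ h₁ g₂-unitri h₂-unitri b))

  δ-zero : ∀ g g′ → δ (λ _ → O) g g′ ≈ O
  δ-zero (g₁ , g₂) g′ a b = begin
    (actS (g₁ , g₂) O a b + - 0#) + 0# ≡⟨ +-identityʳ _ ⟩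
    actS (g₁ , g₂) O a b + - 0#        ≡⟨ cong (_+ - 0#) act-zero ⟩
    0# + - 0#                          ≡⟨ -‿inverseʳ 0# ⟩
    0#                                 ∎
    where
    act-zero : actS (g₁ , g₂) O a b ≡ 0#
    act-zero = trans (·-cong {m} {m} {m} (·-zeroʳ (π g₁)) (≈-refl {A = uinv p (π' g₂)}) a b) (·-zeroˡ {m} (uinv p (π' g₂)) a b)
    open ≡-Reasoning

  -- Its top-left block is g₁ and its
  -- bottom-right (m+1)-block is g₂, because the corner entry is 1 in both.
  C : M₁ → Mat p (ℕ.suc m) m
  C g = withLastRow O (ψ g)

  sec : Gm → Mat p n n
  sec (g₁ , g₂) = blk g₁ (C g₂) (π' g₂)

  cast-by-toℕ : ∀ {a b} .(eq : a ≡ b) {i : Fin a} {j : Fin b} → toℕ i ≡ toℕ j → cast eq i ≡ j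
  cast-by-toℕ eq {i} e = toℕ-injective (trans (toℕ-cast eq i) e)

  shiftR-zero : shiftR zero ≡ last ↑ˡ m
  shiftR-zero = cast-by-toℕ _ (trans (toℕ-↑ʳ m (zero {m})) (trans (ℕ.+-identityʳ m)
                  (sym (trans (toℕ-↑ˡ last m) (toℕ-fromℕ m)))))

  shiftR-suc : ∀ b → shiftR (suc b) ≡ ℕ.suc m ↑ʳ b
  shiftR-suc b = cast-by-toℕ _ (trans (toℕ-↑ʳ m (suc b)) (trans (ℕ.+-suc m (toℕ b)) (sym (toℕ-↑ʳ (ℕ.suc m) b))))

  sec-bottomRight : ∀ {g₁ g₂} → IsUnitri p g₁ → IsUnitri p g₂ → bottomRight (sec (g₁ , g₂)) ≈ g₂
  sec-bottomRight {g₁} {g₂} g₁-unitri g₂-unitri = entry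
    where
    S : Mat p n n
    S = sec (g₁ , g₂)
    open ≡-Reasoning
    entry : ∀ i j → S (shiftR i) (shiftR j) ≡ g₂ i j
    entry zero zero = begin
      S (shiftR zero) (shiftR zero) ≡⟨ cong₂ S shiftR-zero shiftR-zero ⟩
      S (last ↑ˡ m) (last ↑ˡ m)     ≡⟨ blk-ff g₁ (C g₂) (π' g₂) last last ⟩
      g₁ last last                  ≡⟨ proj₂ (g₁-unitri last last) refl ⟩
      1#                            ≡⟨ proj₂ (g₂-unitri zero zero) refl ⟨
      g₂ zero zero                  ∎
    entry zero (suc c) = begin
      S (shiftR zero) (shiftR (suc c)) ≡⟨ cong₂ S shiftR-zero (shiftR-suc c) ⟩
      S (last ↑ˡ m) (ℕ.suc m ↑ʳ c)     ≡⟨ blk-fs g₁ (C g₂) (π' g₂) last c ⟩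
      C g₂ last c                      ≡⟨ cong (λ row → row c) (withLastRow-last (O {m}) (ψ g₂)) ⟩
      g₂ zero (suc c)                  ∎
    entry (suc a) zero = begin
      S (shiftR (suc a)) (shiftR zero) ≡⟨ cong₂ S (shiftR-suc a) shiftR-zero ⟩
      S (ℕ.suc m ↑ʳ a) (last ↑ˡ m)     ≡⟨ blk-sf g₁ (C g₂) (π' g₂) a last ⟩
      0#                               ≡⟨ proj₁ (g₂-unitri (suc a) zero) (ℕ.s≤s ℕ.z≤n) ⟨
      g₂ (suc a) zero                  ∎
    entry (suc a) (suc c) = trans (cong₂ S (shiftR-suc a) (shiftR-suc c)) (blk-ss g₁ (C g₂) (π' g₂) a c)

  sec-isSection : IsSection sec
  sec-isSection (g₁ , g₂) (g₁-unitri , g₂-unitri) =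
      blk-unitri (C g₂) g₁-unitri (π'-unitri g₂-unitri)
    , blk-ff g₁ (C g₂) (π' g₂)
    , sec-bottomRight g₁-unitri g₂-unitri

  module _ (X : Mat p m m) where

    private
      cast′ : Fin n → Fin (m ℕ.+ ℕ.suc m)
      cast′ = cast (sym (ℕ.+-suc m m))

    embedS-firstColumns : ∀ i y → embedS X i (y ↑ˡ m) ≡ 0#
    embedS-firstColumns i y with splitAt m (cast′ i)
    ... | inj₁ _ rewrite splitAt-↑ˡ (ℕ.suc m) y m = refl
    ... | inj₂ _ = refl

    embedS-lowerRows : ∀ a j → embedS X (ℕ.suc m ↑ʳ a) j ≡ 0#
    embedS-lowerRows a j
      rewrite cast-by-toℕ (sym (ℕ.+-suc m m)) {ℕ.suc m ↑ʳ a} {m ↑ʳ suc a}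
                (trans (toℕ-↑ʳ (ℕ.suc m) a) (sym (trans (toℕ-↑ʳ m (suc a)) (ℕ.+-suc m (toℕ a)))))
            | splitAt-↑ʳ m (ℕ.suc m) (suc a) = refl

    embedS-middleRow : ∀ j → embedS X (last ↑ˡ m) j ≡ 0#
    embedS-middleRow j
      rewrite cast-by-toℕ (sym (ℕ.+-suc m m)) {last ↑ˡ m} {m ↑ʳ zero}
                (trans (toℕ-↑ˡ last m) (trans (toℕ-fromℕ m) (sym (trans (toℕ-↑ʳ m (zero {m})) (ℕ.+-identityʳ m)))))
            | splitAt-↑ʳ m (ℕ.suc m) (zero {m}) = refl

    embedS-topRight : ∀ a b → embedS X (inject₁ a ↑ˡ m) (ℕ.suc m ↑ʳ b) ≡ X a b
    embedS-topRight a b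
      rewrite cast-by-toℕ (sym (ℕ.+-suc m m)) {inject₁ a ↑ˡ m} {a ↑ˡ ℕ.suc m}
                (trans (toℕ-↑ˡ (inject₁ a) m) (trans (toℕ-inject₁ a) (sym (toℕ-↑ˡ a (ℕ.suc m)))))
            | splitAt-↑ˡ m a (ℕ.suc m)
            | splitAt-↑ʳ (ℕ.suc m) m b = refl

    embedS-blk : embedS X ≈ blk O (withLastRow X (λ _ → 0#)) O
    embedS-blk i j = by-blocks (side (ℕ.suc m) i) (side (ℕ.suc m) j)
      where
      X̂ : Mat p (ℕ.suc m) m
      X̂ = withLastRow X (λ _ → 0#)
      top-right : (λ x y → embedS X (x ↑ˡ m) (ℕ.suc m ↑ʳ y)) ≈ X̂
      top-right = rows-ext
        (λ a b → trans (embedS-topRight a b) (sym (cong (λ row → row b) (withLastRow-inject₁ X (λ _ → 0#) a))))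
        (λ b → trans (embedS-middleRow _) (sym (cong (λ row → row b) (withLastRow-last X (λ _ → 0#)))))
      by-blocks : ∀ {i j} → Side (ℕ.suc m) m i → Side (ℕ.suc m) m j → embedS X i j ≡ blk O X̂ O i j
      by-blocks (first x)  (first y)  = trans (embedS-firstColumns _ y) (sym (blk-ff O X̂ O x y))
      by-blocks (first x)  (second y) = trans (top-right x y) (sym (blk-fs O X̂ O x y))
      by-blocks (second x) (first y)  = trans (embedS-lowerRows x (y ↑ˡ m)) (sym (blk-sf O X̂ O x y))
      by-blocks (second x) (second y) = trans (embedS-lowerRows x (ℕ.suc m ↑ʳ y)) (sym (blk-ss O X̂ O x y))

  -- On the first m rows they agree precisely when
  -- X π'(g₂h₂) = φ(g₁) ψ(h₂); on the last row they agree because ψ is a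
  -- crossed homomorphism.
  offDiagonal : ∀ {g₁ g₂} h₂ (X : Mat p m m) → IsUnitri p g₁ → IsUnitri p g₂ →
                X · π' (g₂ · h₂) ≈ pair (φ g₁) (ψ h₂) →
                g₁ · C h₂ ⊕ C g₂ · π' h₂ ≈ C (g₂ · h₂) ⊕ withLastRow X (λ _ → 0#) · π' (g₂ · h₂)
  offDiagonal {g₁} {g₂} h₂ X g₁-unitri g₂-unitri X·P≈φψ i j = begin
    (g₁ · C h₂ ⊕ C g₂ · π' h₂) i j       ≡⟨ ⊕-cong (·-lastRowOnly g₁ (ψ h₂)) (withLastRow-· O (ψ g₂) (π' h₂)) i j ⟩
    L i j                                 ≡⟨ rows-ext {M = L} {M′ = R} upper-rows last-row i j ⟩
    R i j                                 ≡⟨ ⊕-cong {A = C (g₂ · h₂)} ≈-refl (withLastRow-· X zero-row P) i j ⟨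
    (C (g₂ · h₂) ⊕ withLastRow X zero-row · P) i j ∎
    where
    P : Mat p m m
    P = π' (g₂ · h₂)
    zero-row : Fin m → F p
    zero-row _ = 0#
    L R : Mat p (ℕ.suc m) m
    L = (λ x b → g₁ x last * ψ h₂ b) ⊕ withLastRow (O · π' h₂) (ψ g₂ ᵣ· π' h₂)
    R = C (g₂ · h₂) ⊕ withLastRow (X · P) (zero-row ᵣ· P)
    open ≡-Reasoning

    upper-rows : ∀ a b → L (inject₁ a) b ≡ R (inject₁ a) b
    upper-rows a b = begin
      φ g₁ a * ψ h₂ b + withLastRow (O · π' h₂) (ψ g₂ ᵣ· π' h₂) (inject₁ a) b
        ≡⟨ cong (λ row → φ g₁ a * ψ h₂ b + row b) (withLastRow-inject₁ (O · π' h₂) (ψ g₂ ᵣ· π' h₂) a) ⟩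
      φ g₁ a * ψ h₂ b + (O · π' h₂) a b    ≡⟨ cong (φ g₁ a * ψ h₂ b +_) (·-zeroˡ (π' h₂) a b) ⟩
      φ g₁ a * ψ h₂ b + 0#                 ≡⟨ +-identityʳ _ ⟩
      φ g₁ a * ψ h₂ b                      ≡⟨ X·P≈φψ a b ⟨
      (X · P) a b                          ≡⟨ +-identityˡ _ ⟨
      0# + (X · P) a b                     ≡⟨ cong₂ (λ r₁ r₂ → r₁ b + r₂ b) (withLastRow-inject₁ (O {m}) (ψ (g₂ · h₂)) a)
                                                                          (withLastRow-inject₁ (X · P) (zero-row ᵣ· P) a) ⟨
      R (inject₁ a) b                      ∎

    last-row : ∀ b → L last b ≡ R last b
    last-row b = begin
      g₁ last last * ψ h₂ b + withLastRow (O · π' h₂) (ψ g₂ ᵣ· π' h₂) last b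
        ≡⟨ cong₂ (λ x row → x * ψ h₂ b + row b) (proj₂ (g₁-unitri last last) refl) (withLastRow-last (O {m} · π' h₂) (ψ g₂ ᵣ· π' h₂)) ⟩
      1# * ψ h₂ b + (ψ g₂ ᵣ· π' h₂) b      ≡⟨ cong (_+ (ψ g₂ ᵣ· π' h₂) b) (*-identityˡ (ψ h₂ b)) ⟩
      ψ h₂ b + (ψ g₂ ᵣ· π' h₂) b           ≡⟨ ψ-· h₂ g₂-unitri b ⟨
      ψ (g₂ · h₂) b                        ≡⟨ +-identityʳ _ ⟨
      ψ (g₂ · h₂) b + 0#                   ≡⟨ cong (ψ (g₂ · h₂) b +_) (ΣF-zeros (λ l → zeroˡ (P l b))) ⟨
      ψ (g₂ · h₂) b + (zero-row ᵣ· P) b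
        ≡⟨ cong₂ (λ r₁ r₂ → r₁ b + r₂ b) (withLastRow-last (O {m}) (ψ (g₂ · h₂))) (withLastRow-last (X · P) (zero-row ᵣ· P)) ⟨
      R last b                             ∎

  sec-cocycle : CocycleIs sec (λ g g′ → cup g g′ ⊕ δ (λ _ → O) g g′)
  sec-cocycle (g₁ , g₂) (h₁ , h₂) (g₁-unitri , g₂-unitri) (_ , h₂-unitri) = begin
    sec g · sec g′
      ≈⟨ blk-· g₁ h₁ (C g₂) (C h₂) (π' g₂) (π' h₂) ⟩
    blk (g₁ · h₁) (g₁ · C h₂ ⊕ C g₂ · π' h₂) (π' g₂ · π' h₂)
      ≈⟨ blk-cong ≈-refl (offDiagonal h₂ X g₁-unitri g₂-unitri X·P≈φψ) (≈-sym (π'-· h₂ g₂-unitri)) ⟩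
    blk (g₁ · h₁) (C (g₂ · h₂) ⊕ X̂ · π' (g₂ · h₂)) (π' (g₂ · h₂))
      ≈⟨ shear X̂ (g₁ · h₁) (C (g₂ · h₂)) (π' (g₂ · h₂)) ⟨
    (I ⊕ blk O X̂ O) · sec (g ∙G g′)
      ≈⟨ ·-cong {B = sec (g ∙G g′)} (⊕-cong {A = I} ≈-refl (embedS-blk X)) ≈-refl ⟨
    (I ⊕ embedS X) · sec (g ∙G g′)
      ∎
    where
    g g′ : Gm
    g  = g₁ , g₂
    g′ = h₁ , h₂
    X : Mat p m m
    X = cup g g′ ⊕ δ (λ _ → O) g g′
    X̂ : Mat p (ℕ.suc m) m
    X̂ = withLastRow X (λ _ → 0#)
    X≈cup : X ≈ cup g g′
    X≈cup a b = trans (cong (cup g g′ a b +_) (δ-zero g g′ a b)) (+-identityʳ _)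
    X·P≈φψ : X · π' (g₂ · h₂) ≈ pair (φ g₁) (ψ h₂)
    X·P≈φψ a b = trans (·-cong {B = π' (g₂ · h₂)} X≈cup ≈-refl a b) (cup-· g₁ h₁ g₂-unitri h₂-unitri a b)
    open SetoidReasoning (≈-setoid _ _)

-- The section s, together with the zero cochain, exhibits the class of
-- the extension as the cup product.
theorem5p1 : (p : ℕ) .{{_ : NonZero p}} → Prime p → (m : ℕ) → 1 ≤ m →
    Setting.ExtensionClassIs p m (Setting.cup p m)
theorem5p1 p _ m _ = sec , sec-isSection , (λ _ → O) , sec-cocycle
  where
  open Extension p m
  open Matrices p using (O)
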